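{- If $\pi,\rho\in S_n$ have their LTR maxima in the same positions, i.e. $LTR(\pi)=LTR(\rho)$, then $|q^{ -1}(\pi)|=|q^{ -1}(\rho)|$.
   Context: $S_n$ is the set of permutations of $\{1,\dots,n\}$ in one-line notation $\pi=\pi_1\cdots\pi_n$. An entry $\pi_i$ is a left-to-right (LTR) maximum if $\pi_i>\pi_j$ for all $j<i$; $LTR(\pi)=\{i\le n:\pi_i\text{ is an LTR maximum of }\pi\}$. The map $q:S_n\to S_n$ (the algorithm Queuesort, sorting with a queue allowing bypass): let $m_1,\dots,m_r$ be the LTR maxima of $\pi$ from left to right; for $i=r,\dots,1$ in this order, repeatedly swap $m_i$ with the entry immediately to its right as long as such an entry exists and is smaller than $m_i$; the result is $q(\pi)$. $q^{ -1}(\pi)=\{\sigma\in S_n: q(\sigma)=\pi\}$. -}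

module Defs where

open import Data.Nat using (ℕ; zero; suc)
open import Data.Fin using (Fin; _<_)
open import Data.Fin.Properties using (_≟_; _<?_; all?)
open import Data.Vec using (Vec; []; _∷_; lookup; toList)
open import Data.Vec.Properties using (≡-dec)
open import Data.List using (List; []; _∷_; [_]; map; concatMap; filter; length; foldr)
open import Data.List.Base using (allFin)
open import Data.Maybe using (Maybe; just; nothing)
open import Data.Product using (_×_)
open import Relation.Nullary using (Dec; yes; no)
open import Relation.Nullary.Decidable using (_×-dec_; _→-dec_)
open import Relation.Binary.PropositionalEquality using (_≡_)

-- A word of length n over {0,…,n-1} (one-line notation; value k stands for k+1).
Word : ℕ → Set
Word n = Vec (Fin n) n

IsPerm : ∀ {n} → Word n → Set
IsPerm {n} σ = ∀ (i j : Fin n) → lookup σ i ≡ lookup σ j → i ≡ j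

isPerm? : ∀ {n} (σ : Word n) → Dec (IsPerm σ)
isPerm? σ = all? λ i → all? λ j → (lookup σ i ≟ lookup σ j) →-dec (i ≟ j)

IsLTR : ∀ {n} → Word n → Fin n → Set
IsLTR {n} π i = ∀ (j : Fin n) → j < i → lookup π j < lookup π i

module _ {n : ℕ} where

  bubble : ∀ {k} → Fin n → Vec (Fin n) k → Vec (Fin n) (suc k)
  bubble m []       = m ∷ []
  bubble m (x ∷ xs) with x <? m
  ... | yes _ = x ∷ bubble m xs
  ... | no  _ = m ∷ x ∷ xs

  moveRight : ∀ {k} → Fin n → Vec (Fin n) k → Vec (Fin n) k
  moveRight m []       = []
  moveRight m (x ∷ xs) with x ≟ m
  ... | yes _ = bubble m xs
  ... | no  _ = x ∷ moveRight m xs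

  ltrMaxFrom : Maybe (Fin n) → List (Fin n) → List (Fin n)
  ltrMaxFrom _        []       = []
  ltrMaxFrom nothing  (x ∷ xs) = x ∷ ltrMaxFrom (just x) xs
  ltrMaxFrom (just m) (x ∷ xs) with m <? x
  ... | yes _ = x ∷ ltrMaxFrom (just x) xs
  ... | no  _ = ltrMaxFrom (just m) xs

  ltrMaxima : ∀ {k} → Vec (Fin n) k → List (Fin n)
  ltrMaxima v = ltrMaxFrom nothing (toList v)

-- q(π): with LTR maxima m₁,…,m_r, process m_r first, then …, m₁ last
-- (foldr applies the function for m_r innermost, i.e. first).
q : ∀ {n} → Word n → Word n
q π = foldr moveRight π (ltrMaxima π)

allWords : ∀ {n} (k : ℕ) → List (Vec (Fin n) k)
allWords {n} zero    = [ [] ]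
allWords {n} (suc k) = concatMap (λ x → map (x ∷_) (allWords k)) (allFin n)

preimageSize : ∀ {n} → Word n → ℕ
preimageSize {n} π =
  length (filter (λ σ → isPerm? σ ×-dec ≡-dec _≟_ (q σ) π) (allWords n))

-- Let g be the relabelling of values with g(π_i) = ρ_i. Every comparison a < b that
-- Queuesort makes is between a left-to-right maximum b of its output and an entry a
-- that precedes b there. So if q(σ) = π, the hypothesis LTR(π) = LTR(ρ) guarantees
-- that g preserves all these comparisons, whence q(g ∘ σ) = g ∘ q(σ) = ρ. Symmetrically
-- g⁻¹ maps q⁻¹(ρ) back into q⁻¹(π), and relabelling by a bijection preserves counts.
module Submission where

open import Defs
open import Data.Nat using (ℕ)
open import Data.Fin using (Fin)
open import Function.Bundles using (_⇔_)
open import Relation.Binary.PropositionalEquality using (_≡_)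

open import Data.Nat using (zero; suc; _+_; z≤n; s≤s)
import Data.Nat.Properties as ℕ
open import Data.Nat.ListAction using (sum)
open import Data.Fin using (zero; suc; _<_; _≤_; punchOut)
open import Data.Fin.Properties
  using (_≟_; _<?_; any?; <-trans; <-asym; <-irrefl; <⇒≢; ≤-refl; ≤-trans; ≤∧≢⇒<;
         punchOut-injective; injective⇒≤)
open import Data.Fin.Permutation using (permutation)
import Algebra.Properties.CommutativeMonoid.Sum ℕ.+-0-commutativeMonoid as Σ
open import Data.Vec as V using (Vec; []; _∷_; lookup; toList)
import Data.Vec.Properties as V
open import Data.Vec.Properties using (≡-dec)
open import Data.Vec.Relation.Binary.Equality.Cast using (cast-is-id)
open import Data.List as L using (List; []; _∷_; foldr; length; filter; concatMap; allFin)
import Data.List.Properties as L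
open import Data.List.Relation.Unary.All as All using (All; []; _∷_)
open import Data.List.Relation.Unary.AllPairs using (_∷_)
open import Data.List.Relation.Unary.Unique.Propositional using (Unique)
open import Data.List.Relation.Unary.Unique.Propositional.Properties using (tabulate⁺)
open import Data.Maybe using (Maybe; just; nothing)
open import Data.Product using (∃; ∃₂; _×_; _,_; proj₁; proj₂)
open import Function using (_∘_; id)
open import Function.Definitions using (Injective)
open import Function.Bundles using (Equivalence)
open import Relation.Nullary using (Dec; yes; no; ¬_; contradiction)
open import Relation.Nullary.Decidable using (_×-dec_)
open import Relation.Unary using (Pred; Decidable)
open import Relation.Binary.PropositionalEquality
  using (_≢_; refl; sym; trans; cong; subst; subst₂; module ≡-Reasoning)

toList-tabulate-lookup : ∀ {a} {A : Set a} {k} (v : Vec A k) → toList v ≡ L.tabulate (lookup v)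
toList-tabulate-lookup []      = refl
toList-tabulate-lookup (x ∷ v) = cong (x ∷_) (toList-tabulate-lookup v)

unique-toList : ∀ {a} {A : Set a} {k} (v : Vec A k) →
                (∀ i j → lookup v i ≡ lookup v j → i ≡ j) → Unique (toList v)
unique-toList v inj = subst Unique (sym (toList-tabulate-lookup v)) (tabulate⁺ (inj _ _))

injective⇒surjective : ∀ {m} (f : Fin m → Fin m) → Injective _≡_ _≡_ f → ∀ a → ∃ λ i → f i ≡ a
injective⇒surjective {suc m} f f-inj a with any? (λ i → f i ≟ a)
... | yes hit  = hit
... | no  miss = contradiction (injective⇒≤ f∖a-inj) (ℕ.n≮n m)
  where
  a≢f : ∀ i → a ≢ f i
  a≢f i a≡fi = miss (i , sym a≡fi)
  f∖a : Fin (suc m) → Fin m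
  f∖a i = punchOut (a≢f i)
  f∖a-inj : Injective _≡_ _≡_ f∖a
  f∖a-inj e = f-inj (punchOut-injective (a≢f _) (a≢f _) e)

module _ {a b p} {A : Set a} {B : Set b} {P : Pred B p} (P? : Decidable P) where

  count-map : ∀ (f : A → B) xs → length (filter P? (L.map f xs)) ≡ length (filter (P? ∘ f) xs)
  count-map f []       = refl
  count-map f (x ∷ xs) with P? (f x)
  ... | yes _ = cong suc (count-map f xs)
  ... | no  _ = count-map f xs

  count-concatMap : ∀ (f : A → List B) xs →
    length (filter P? (concatMap f xs)) ≡ sum (L.map (λ x → length (filter P? (f x))) xs)
  count-concatMap f []       = refl
  count-concatMap f (x ∷ xs) =
    trans (cong length (L.filter-++ P? (f x) (concatMap f xs)))
          (trans (L.length-++ (filter P? (f x)))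
                 (cong (length (filter P? (f x)) +_) (count-concatMap f xs)))

sum-tabulate : ∀ {m} (F : Fin m → ℕ) → sum (L.tabulate F) ≡ Σ.sum F
sum-tabulate {zero}  F = refl
sum-tabulate {suc m} F = cong (F zero +_) (sum-tabulate (F ∘ suc))

sum-allFin-permute : ∀ {m} (g h : Fin m → Fin m) → (∀ a → g (h a) ≡ a) → (∀ a → h (g a) ≡ a) →
  ∀ (F : Fin m → ℕ) → sum (L.map (F ∘ g) (allFin m)) ≡ sum (L.map F (allFin m))
sum-allFin-permute {m} g h gh hg F = begin
  sum (L.map (F ∘ g) (allFin m))  ≡⟨ cong sum (L.map-tabulate id (F ∘ g)) ⟩
  sum (L.tabulate (F ∘ g))        ≡⟨ sum-tabulate (F ∘ g) ⟩
  Σ.sum (F ∘ g)                   ≡⟨ Σ.sum-permute F (permutation g h gh hg) ⟨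
  Σ.sum F                         ≡⟨ sum-tabulate F ⟨
  sum (L.tabulate F)              ≡⟨ cong sum (L.map-tabulate id F) ⟨
  sum (L.map F (allFin m))        ∎
  where open ≡-Reasoning

module _ {n : ℕ} (g h : Fin n → Fin n) (gh : ∀ a → g (h a) ≡ a) (hg : ∀ a → h (g a) ≡ a) where

  count-allWords-relabel : ∀ k {p} {P : Pred (Vec (Fin n) k) p} (P? : Decidable P) →
    length (filter (P? ∘ V.map g) (allWords k)) ≡ length (filter P? (allWords k))
  count-allWords-relabel zero    P? with P? []
  ... | yes _ = refl
  ... | no  _ = refl
  count-allWords-relabel (suc k) P? = begin
    length (filter (P? ∘ V.map g) (allWords (suc k)))
      ≡⟨ count-concatMap (P? ∘ V.map g) prepend (allFin n) ⟩
    sum (L.map (λ x → length (filter (P? ∘ V.map g) (prepend x))) (allFin n))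
      ≡⟨ cong sum (L.map-cong (λ x → trans (count-map (P? ∘ V.map g) (x ∷_) W)
                                            (count-allWords-relabel k (P? ∘ (g x ∷_)))) (allFin n)) ⟩
    sum (L.map (F ∘ g) (allFin n))
      ≡⟨ sum-allFin-permute g h gh hg F ⟩
    sum (L.map F (allFin n))
      ≡⟨ cong sum (L.map-cong (λ x → count-map P? (x ∷_) W) (allFin n)) ⟨
    sum (L.map (λ x → length (filter P? (prepend x))) (allFin n))
      ≡⟨ count-concatMap P? prepend (allFin n) ⟨
    length (filter P? (allWords (suc k))) ∎
    where
    open ≡-Reasoning
    W : List (Vec (Fin n) k)
    W = allWords k
    prepend : Fin n → List (Vec (Fin n) (suc k))
    prepend x = L.map (x ∷_) W
    F : Fin n → ℕ
    F y = length (filter (P? ∘ (y ∷_)) W)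

module _ {n : ℕ} where

  bubbleList : Fin n → List (Fin n) → List (Fin n)
  bubbleList m []       = m ∷ []
  bubbleList m (x ∷ xs) with x <? m
  ... | yes _ = x ∷ bubbleList m xs
  ... | no  _ = m ∷ x ∷ xs

  moveRightList : Fin n → List (Fin n) → List (Fin n)
  moveRightList m []       = []
  moveRightList m (x ∷ xs) with x ≟ m
  ... | yes _ = bubbleList m xs
  ... | no  _ = x ∷ moveRightList m xs

  toList-bubble : ∀ {k} m (v : Vec (Fin n) k) → toList (bubble m v) ≡ bubbleList m (toList v)
  toList-bubble m []      = refl
  toList-bubble m (x ∷ v) with x <? m
  ... | yes _ = cong (x ∷_) (toList-bubble m v)
  ... | no  _ = refl

  toList-moveRight : ∀ {k} m (v : Vec (Fin n) k) →
                     toList (moveRight m v) ≡ moveRightList m (toList v)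
  toList-moveRight m []      = refl
  toList-moveRight m (x ∷ v) with x ≟ m
  ... | yes _ = toList-bubble m v
  ... | no  _ = cong (x ∷_) (toList-moveRight m v)

  toList-foldr-moveRight : ∀ {k} (v : Vec (Fin n) k) ms →
                           toList (foldr moveRight v ms) ≡ foldr moveRightList (toList v) ms
  toList-foldr-moveRight v []       = refl
  toList-foldr-moveRight v (m ∷ ms) =
    trans (toList-moveRight m (foldr moveRight v ms))
          (cong (moveRightList m) (toList-foldr-moveRight v ms))

  queuesortFrom : Maybe (Fin n) → List (Fin n) → List (Fin n)
  queuesortFrom _        []       = []
  queuesortFrom nothing  (x ∷ xs) = bubbleList x (queuesortFrom (just x) xs)
  queuesortFrom (just m) (x ∷ xs) with m <? x
  ... | yes _ = bubbleList x (queuesortFrom (just x) xs)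
  ... | no  _ = x ∷ queuesortFrom (just m) xs

  ltrMaxFrom-above : ∀ (m : Fin n) xs → All (m <_) (ltrMaxFrom (just m) xs)
  ltrMaxFrom-above m []       = []
  ltrMaxFrom-above m (x ∷ xs) with m <? x
  ... | yes m<x = m<x ∷ All.map (<-trans m<x) (ltrMaxFrom-above x xs)
  ... | no  _   = ltrMaxFrom-above m xs

  foldr-moveRight-skip : ∀ (x : Fin n) w ms → All (x ≢_) ms →
                         foldr moveRightList (x ∷ w) ms ≡ x ∷ foldr moveRightList w ms
  foldr-moveRight-skip x w []       []          = refl
  foldr-moveRight-skip x w (y ∷ ms) (x≢y ∷ x≢ms)
    rewrite foldr-moveRight-skip x w ms x≢ms with x ≟ y
  ... | yes x≡y = contradiction x≡y x≢y
  ... | no  _   = refl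

  moveRight-head : ∀ m w → moveRightList m (m ∷ w) ≡ bubbleList m w
  moveRight-head m w with m ≟ m
  ... | yes _   = refl
  ... | no  m≢m = contradiction refl m≢m

  -- Later maxima are larger than x, so moving them first never touches x.
  foldr-moveRight-newMax : ∀ (x : Fin n) xs →
    foldr moveRightList (x ∷ xs) (x ∷ ltrMaxFrom (just x) xs) ≡
    bubbleList x (foldr moveRightList xs (ltrMaxFrom (just x) xs))
  foldr-moveRight-newMax x xs = begin
    moveRightList x (foldr moveRightList (x ∷ xs) (ltrMaxFrom (just x) xs))
      ≡⟨ cong (moveRightList x)
              (foldr-moveRight-skip x xs _ (All.map <⇒≢ (ltrMaxFrom-above x xs))) ⟩
    moveRightList x (x ∷ foldr moveRightList xs (ltrMaxFrom (just x) xs))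
      ≡⟨ moveRight-head x _ ⟩
    bubbleList x (foldr moveRightList xs (ltrMaxFrom (just x) xs)) ∎
    where open ≡-Reasoning

  foldr-moveRight-ltrMaxFrom : ∀ (mb : Maybe (Fin n)) xs →
    foldr moveRightList xs (ltrMaxFrom mb xs) ≡ queuesortFrom mb xs
  foldr-moveRight-ltrMaxFrom mb       []       = refl
  foldr-moveRight-ltrMaxFrom nothing  (x ∷ xs) =
    trans (foldr-moveRight-newMax x xs)
          (cong (bubbleList x) (foldr-moveRight-ltrMaxFrom (just x) xs))
  foldr-moveRight-ltrMaxFrom (just m) (x ∷ xs) with m <? x
  ... | yes _   = trans (foldr-moveRight-newMax x xs)
                        (cong (bubbleList x) (foldr-moveRight-ltrMaxFrom (just x) xs))
  ... | no  m≮x = trans (foldr-moveRight-skip x xs _ (All.map x≢ (ltrMaxFrom-above m xs)))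
                        (cong (x ∷_) (foldr-moveRight-ltrMaxFrom (just m) xs))
    where
    x≢ : ∀ {y} → m < y → x ≢ y
    x≢ m<y refl = m≮x m<y

  toList-q : (σ : Word n) → toList (q σ) ≡ queuesortFrom nothing (toList σ)
  toList-q σ = trans (toList-foldr-moveRight σ (ltrMaxima σ))
                     (foldr-moveRight-ltrMaxFrom nothing (toList σ))

  data LTRMax : List (Fin n) → Fin n → Set where
    here  : ∀ {b w} → LTRMax (b ∷ w) b
    there : ∀ {c b w} → c < b → LTRMax w b → LTRMax (c ∷ w) b

  data BeforeLTRMax : List (Fin n) → Fin n → Fin n → Set where
    here  : ∀ {a b w} → a < b → LTRMax w b → BeforeLTRMax (a ∷ w) a b
    there : ∀ {c a b w} → c < b → BeforeLTRMax w a b → BeforeLTRMax (c ∷ w) a b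

  bubble-pass : ∀ {x m} w → x < m → bubbleList m (x ∷ w) ≡ x ∷ bubbleList m w
  bubble-pass {x} {m} w x<m with x <? m
  ... | yes _   = refl
  ... | no  x≮m = contradiction x<m x≮m

  LTRMax-bubble : ∀ m w → LTRMax (bubbleList m w) m
  LTRMax-bubble m []       = here
  LTRMax-bubble m (x ∷ xs) with x <? m
  ... | yes x<m = there x<m (LTRMax-bubble m xs)
  ... | no  _   = here

  bubble-LTRMax : ∀ {m b w} → m < b → LTRMax w b → LTRMax (bubbleList m w) b
  bubble-LTRMax {m} {w = c ∷ w} m<b here with c <? m
  ... | yes _ = here
  ... | no  _ = there m<b here
  bubble-LTRMax {m} {w = c ∷ w} m<b (there c<b l) with c <? m
  ... | yes _ = there c<b (bubble-LTRMax m<b l)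
  ... | no  _ = there m<b (there c<b l)

  bubble-BeforeLTRMax : ∀ {m a b w} → m < b → BeforeLTRMax w a b →
                        BeforeLTRMax (bubbleList m w) a b
  bubble-BeforeLTRMax {m} {w = c ∷ w} m<b (here a<b l) with c <? m
  ... | yes _ = here a<b (bubble-LTRMax m<b l)
  ... | no  _ = there m<b (here a<b l)
  bubble-BeforeLTRMax {m} {w = c ∷ w} m<b (there c<b r) with c <? m
  ... | yes _ = there c<b (bubble-BeforeLTRMax m<b r)
  ... | no  _ = there m<b (there c<b r)

  -- m stops in front of the first entry that is not smaller, at the latest b.
  bubble-stopsBeforeLTRMax : ∀ {m b w} → m < b → LTRMax w b → BeforeLTRMax (bubbleList m w) m b
  bubble-stopsBeforeLTRMax {m} {w = c ∷ w} m<b here with c <? m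
  ... | yes c<m = contradiction (<-trans c<m m<b) (<-irrefl refl)
  ... | no  _   = here m<b here
  bubble-stopsBeforeLTRMax {m} {w = c ∷ w} m<b (there c<b l) with c <? m
  ... | yes _ = there c<b (bubble-stopsBeforeLTRMax m<b l)
  ... | no  _ = here m<b (there c<b l)

  ≮∧≢⇒> : ∀ {m x : Fin n} → ¬ m < x → m ≢ x → x < m
  ≮∧≢⇒> m≮x m≢x = ≤∧≢⇒< (ℕ.≮⇒≥ m≮x) (m≢x ∘ sym)

  module Relabel (g : Fin n → Fin n) where

    -- The recursion only needs the comparisons against maxima b ≥ k.
    MonotoneOn : List (Fin n) → Fin n → Set
    MonotoneOn w k = ∀ {a b} → BeforeLTRMax w a b → k ≤ b → g a < g b

    MonotoneOn-∷ : ∀ {x m w} → x < m → LTRMax w m → MonotoneOn (x ∷ w) m →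
                   g x < g m × MonotoneOn w m
    MonotoneOn-∷ x<m l mono =
      mono (here x<m l) ≤-refl , λ r m≤b → mono (there (ℕ.<-≤-trans x<m m≤b) r) m≤b

    MonotoneOn-passed : ∀ {x m} w → x < m → MonotoneOn (bubbleList m (x ∷ w)) m →
                        g x < g m × MonotoneOn (bubbleList m w) m
    MonotoneOn-passed {m = m} w x<m mono =
      MonotoneOn-∷ x<m (LTRMax-bubble m w) (subst (λ v → MonotoneOn v m) (bubble-pass w x<m) mono)

    MonotoneOn-bubble : ∀ {m x w} → m < x → LTRMax w x → MonotoneOn (bubbleList m w) m →
                        g m < g x × MonotoneOn w x
    MonotoneOn-bubble m<x l mono =
      mono (bubble-stopsBeforeLTRMax m<x l) (ℕ.<⇒≤ m<x) ,
      λ r x≤b → mono (bubble-BeforeLTRMax (ℕ.<-≤-trans m<x x≤b) r) (≤-trans (ℕ.<⇒≤ m<x) x≤b)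

    map-bubble : ∀ m w → MonotoneOn (bubbleList m w) m →
                 L.map g (bubbleList m w) ≡ bubbleList (g m) (L.map g w)
    map-bubble m []       mono = refl
    map-bubble m (y ∷ ys) mono with y <? m | g y <? g m
    ... | yes y<m | yes _    =
      cong (g y ∷_) (map-bubble m ys (proj₂ (MonotoneOn-∷ y<m (LTRMax-bubble m ys) mono)))
    ... | yes y<m | no gy≮gm =
      contradiction (proj₁ (MonotoneOn-∷ y<m (LTRMax-bubble m ys) mono)) gy≮gm
    ... | no  y≮m | no _     = refl
    ... | no  y≮m | yes gy<gm with y ≟ m
    ...   | yes refl = contradiction gy<gm (<-irrefl refl)
    ...   | no  y≢m  = contradiction (mono (here m<y here) (ℕ.<⇒≤ m<y)) (<-asym gy<gm)
      where
      m<y : m < y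
      m<y = ≮∧≢⇒> y≮m y≢m

    mutual
      map-queuesortFrom-newMax : ∀ m xs → Unique (m ∷ xs) →
        MonotoneOn (bubbleList m (queuesortFrom (just m) xs)) m →
        L.map g (bubbleList m (queuesortFrom (just m) xs)) ≡
        bubbleList (g m) (queuesortFrom (just (g m)) (L.map g xs))
      map-queuesortFrom-newMax m xs u mono =
        trans (map-bubble m (queuesortFrom (just m) xs) mono)
              (cong (bubbleList (g m)) (map-queuesortFrom m xs u mono))

      map-queuesortFrom : ∀ m xs → Unique (m ∷ xs) →
        MonotoneOn (bubbleList m (queuesortFrom (just m) xs)) m →
        L.map g (queuesortFrom (just m) xs) ≡ queuesortFrom (just (g m)) (L.map g xs)
      map-queuesortFrom m []       u mono = refl
      map-queuesortFrom m (x ∷ xs) ((m≢x ∷ m≢xs) ∷ ux@(_ ∷ uxs)) mono with m <? x | g m <? g x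
      ... | yes m<x | yes _ =
        map-queuesortFrom-newMax x xs ux
          (proj₂ (MonotoneOn-bubble m<x (LTRMax-bubble x (queuesortFrom (just x) xs)) mono))
      ... | yes m<x | no gm≮gx = contradiction
          (proj₁ (MonotoneOn-bubble m<x (LTRMax-bubble x (queuesortFrom (just x) xs)) mono)) gm≮gx
      ... | no  m≮x | yes gm<gx =
        contradiction (proj₁ (MonotoneOn-passed _ (≮∧≢⇒> m≮x m≢x) mono)) (<-asym gm<gx)
      ... | no  m≮x | no _ =
        cong (g x ∷_) (map-queuesortFrom m xs (m≢xs ∷ uxs)
                        (proj₂ (MonotoneOn-passed _ (≮∧≢⇒> m≮x m≢x) mono)))

    map-queuesort : ∀ xs → Unique xs →
      (∀ {a b} → BeforeLTRMax (queuesortFrom nothing xs) a b → g a < g b) →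
      L.map g (queuesortFrom nothing xs) ≡ queuesortFrom nothing (L.map g xs)
    map-queuesort []       _ _    = refl
    map-queuesort (x ∷ xs) u mono = map-queuesortFrom-newMax x xs u (λ r _ → mono r)

  LTRMax-position : ∀ {k b} (v : Vec (Fin n) k) → LTRMax (toList v) b →
    ∃ λ j → lookup v j ≡ b × (∀ l → l < j → lookup v l < b)
  LTRMax-position (x ∷ v) here = zero , refl , λ _ ()
  LTRMax-position (x ∷ v) (there x<b l) with LTRMax-position v l
  ... | j , vj≡b , below = suc j , vj≡b , λ { zero _ → x<b ; (suc l) (s≤s l<j) → below l l<j }

  BeforeLTRMax-positions : ∀ {k a b} (v : Vec (Fin n) k) → BeforeLTRMax (toList v) a b →
    ∃₂ λ i j → i < j × lookup v i ≡ a × lookup v j ≡ b × (∀ l → l < j → lookup v l < lookup v j)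
  BeforeLTRMax-positions (x ∷ v) (here x<b l) with LTRMax-position v l
  ... | j , refl , below = zero , suc j , s≤s z≤n , refl , refl ,
                           λ { zero _ → x<b ; (suc l) (s≤s l<j) → below l l<j }
  BeforeLTRMax-positions (x ∷ v) (there x<b r) with BeforeLTRMax-positions v r
  ... | i , j , i<j , vi≡a , refl , below = suc i , suc j , s≤s i<j , vi≡a , refl ,
                                            λ { zero _ → x<b ; (suc l) (s≤s l<j) → below l l<j }

  q-relabel : ∀ (g : Fin n → Fin n) (σ : Word n) → IsPerm σ →
    (∀ i j → i < j → IsLTR (q σ) j → g (lookup (q σ) i) < g (lookup (q σ) j)) →
    q (V.map g σ) ≡ V.map g (q σ)
  q-relabel g σ σ-perm mono =
    trans (sym (cast-is-id refl _)) (V.toList-injective refl _ _ (begin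
    toList (q (V.map g σ))                      ≡⟨ toList-q (V.map g σ) ⟩
    queuesortFrom nothing (toList (V.map g σ))  ≡⟨ cong (queuesortFrom nothing) (V.toList-map g σ) ⟩
    queuesortFrom nothing (L.map g (toList σ))  ≡⟨ sym (map-queuesort (toList σ) (unique-toList σ σ-perm) mono′) ⟩
    L.map g (queuesortFrom nothing (toList σ))  ≡⟨ cong (L.map g) (sym (toList-q σ)) ⟩
    L.map g (toList (q σ))                      ≡⟨ sym (V.toList-map g (q σ)) ⟩
    toList (V.map g (q σ))                      ∎))
    where
    open ≡-Reasoning
    open Relabel g
    mono′ : ∀ {a b} → BeforeLTRMax (queuesortFrom nothing (toList σ)) a b → g a < g b
    mono′ r with BeforeLTRMax-positions (q σ) (subst (λ w → BeforeLTRMax w _ _) (sym (toList-q σ)) r)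
    ... | i , j , i<j , refl , refl , ltr = mono i j i<j ltr

  preimage-relabel : ∀ (g : Fin n → Fin n) {π ρ : Word n} → V.map g π ≡ ρ →
    (∀ j → IsLTR π j → IsLTR ρ j) → ∀ {σ} → IsPerm σ → q σ ≡ π → q (V.map g σ) ≡ ρ
  preimage-relabel g gπ≡ρ ltr {σ} σ-perm refl = trans (q-relabel g σ σ-perm mono) gπ≡ρ
    where
    gπ : ∀ i → lookup (V.map g (q σ)) i ≡ g (lookup (q σ) i)
    gπ i = V.lookup-map i g (q σ)
    mono : ∀ i j → i < j → IsLTR (q σ) j → g (lookup (q σ) i) < g (lookup (q σ) j)
    mono i j i<j j∈LTR = subst₂ _<_ (gπ i) (gπ j)
      (subst (λ v → lookup v i < lookup v j) (sym gπ≡ρ) (ltr j j∈LTR i i<j))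

  relabelling : (π ρ : Word n) → IsPerm π → Fin n → Fin n
  relabelling π ρ π-perm a = lookup ρ (proj₁ (injective⇒surjective (lookup π) (π-perm _ _) a))

  relabelling-lookup : ∀ π ρ (π-perm : IsPerm π) i → relabelling π ρ π-perm (lookup π i) ≡ lookup ρ i
  relabelling-lookup π ρ π-perm i =
    cong (lookup ρ) (π-perm _ _ (proj₂ (injective⇒surjective (lookup π) (π-perm _ _) (lookup π i))))

  map-relabelling : ∀ π ρ (π-perm : IsPerm π) → V.map (relabelling π ρ π-perm) π ≡ ρ
  map-relabelling π ρ π-perm = begin
    V.map (relabelling π ρ π-perm) π                      ≡⟨ V.tabulate∘lookup _ ⟨
    V.tabulate (lookup (V.map (relabelling π ρ π-perm) π)) ≡⟨ V.tabulate-cong lookup-relabel ⟩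
    V.tabulate (lookup ρ)                                 ≡⟨ V.tabulate∘lookup ρ ⟩
    ρ                                                     ∎
    where
    open ≡-Reasoning
    lookup-relabel : ∀ i → lookup (V.map (relabelling π ρ π-perm) π) i ≡ lookup ρ i
    lookup-relabel i = trans (V.lookup-map i _ π) (relabelling-lookup π ρ π-perm i)

  relabelling-inverse : ∀ π ρ (π-perm : IsPerm π) (ρ-perm : IsPerm ρ) a →
    relabelling ρ π ρ-perm (relabelling π ρ π-perm a) ≡ a
  relabelling-inverse π ρ π-perm ρ-perm a =
    trans (relabelling-lookup ρ π ρ-perm i) πi≡a
    where
    i : Fin n
    i = proj₁ (injective⇒surjective (lookup π) (π-perm _ _) a)
    πi≡a : lookup π i ≡ a
    πi≡a = proj₂ (injective⇒surjective (lookup π) (π-perm _ _) a)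

  isPerm-map : ∀ {g : Fin n → Fin n} → Injective _≡_ _≡_ g → ∀ {σ} → IsPerm σ → IsPerm (V.map g σ)
  isPerm-map {g} g-inj {σ} σ-perm i j e =
    σ-perm i j (g-inj (trans (sym (V.lookup-map i g σ)) (trans e (V.lookup-map j g σ))))

  relabelling-injective : ∀ π ρ (π-perm : IsPerm π) (ρ-perm : IsPerm ρ) →
    Injective _≡_ _≡_ (relabelling π ρ π-perm)
  relabelling-injective π ρ π-perm ρ-perm {a} {b} e =
    trans (sym (relabelling-inverse π ρ π-perm ρ-perm a))
          (trans (cong (relabelling ρ π ρ-perm) e) (relabelling-inverse π ρ π-perm ρ-perm b))

  InPreimage : Word n → Word n → Set
  InPreimage π σ = IsPerm σ × q σ ≡ π

  inPreimage? : ∀ π σ → Dec (InPreimage π σ)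
  inPreimage? π σ = isPerm? σ ×-dec ≡-dec _≟_ (q σ) π

  inPreimage-relabelling : ∀ π ρ (π-perm : IsPerm π) (ρ-perm : IsPerm ρ) →
    (∀ j → IsLTR π j → IsLTR ρ j) →
    ∀ {σ} → InPreimage π σ → InPreimage ρ (V.map (relabelling π ρ π-perm) σ)
  inPreimage-relabelling π ρ π-perm ρ-perm ltr {σ} (σ-perm , qσ≡π) =
    isPerm-map (relabelling-injective π ρ π-perm ρ-perm) {σ} σ-perm ,
    preimage-relabel _ (map-relabelling π ρ π-perm) ltr {σ} σ-perm qσ≡π

corollary4p5 : (n : ℕ) (π ρ : Word n) → IsPerm π → IsPerm ρ →
    (∀ (i : Fin n) → IsLTR π i ⇔ IsLTR ρ i) →
    preimageSize π ≡ preimageSize ρ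
corollary4p5 n π ρ π-perm ρ-perm same-LTR = begin
  preimageSize π
    ≡⟨ cong length (L.filter-≐ _ _ ((λ {σ} → to {σ}) , λ {σ} → from {σ}) (allWords n)) ⟩
  length (filter (inPreimage? ρ ∘ V.map g) (allWords n))
    ≡⟨ count-allWords-relabel g h gh hg n (inPreimage? ρ) ⟩
  preimageSize ρ ∎
  where
  open ≡-Reasoning
  g h : Fin n → Fin n
  g = relabelling π ρ π-perm
  h = relabelling ρ π ρ-perm
  gh : ∀ a → g (h a) ≡ a
  gh = relabelling-inverse ρ π ρ-perm π-perm
  hg : ∀ a → h (g a) ≡ a
  hg = relabelling-inverse π ρ π-perm ρ-perm
  to : ∀ {σ} → InPreimage π σ → InPreimage ρ (V.map g σ)
  to {σ} = inPreimage-relabelling π ρ π-perm ρ-perm (Equivalence.to ∘ same-LTR) {σ}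
  from : ∀ {σ} → InPreimage ρ (V.map g σ) → InPreimage π σ
  from {σ} gσ∈ = subst (InPreimage π) hgσ≡σ
    (inPreimage-relabelling ρ π ρ-perm π-perm (Equivalence.from ∘ same-LTR) {V.map g σ} gσ∈)
    where
    hgσ≡σ : V.map h (V.map g σ) ≡ σ
    hgσ≡σ = trans (sym (V.map-∘ h g σ)) (trans (V.map-cong hg σ) (V.map-id σ))
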